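{- Let $k$ be a power of a prime, $A=\mathbb{F}_k$, $G$ a connected simple graph with vertex set $\{v_1,\dots,v_n\}$ and $m$ edges, $T$ a spanning tree of $G$, and $D$ the canonical orientation of $G$. Suppose $(D,\sigma)$ is an $S_A$-labeling of $G$ such that $\sigma(e)$ is the identity permutation for every arc $e$ corresponding to an edge of $T$. If there is a proper $S_A$-$k$-coloring of $(D,\sigma)$, then there exists a polynomial $f_{(D,\sigma)}\in\mathcal{F}_{G,(D,\sigma)}$ of degree at most $(k-2)(m-n+1)+n-1$.
   Context: $S_A$ is the symmetric group on $A$. An $S_A$-labeling of $G$ is $(D,\sigma)$ with $D$ an orientation of $G$ and $\sigma:E(D)\to S_A$; a proper $S_A$-$k$-coloring is $\kappa:V(G)\to A$ with $\sigma(u,v)(\kappa(u))\ne\kappa(v)$ for all arcs $(u,v)$ (using at most $k$ colors). The canonical orientation $D$ orients each edge $v_iv_j$ with $i<j$ as $(v_i,v_j)$. A polynomial $f\in\mathbb{F}_k[x_1,\dots,x_n]$ covers $(D,\sigma)$ if $f(a_1,\dots,a_n)\ne0$ implies that $\kappa(v_i)=a_i$ defines a proper $S_A$-$k$-coloring of $(D,\sigma)$. $\mathcal{F}_{G,(D,\sigma)}$ is the set of polynomials in $\mathbb{F}_k[x_1,\dots,x_n]$ that cover $(D,\sigma)$ and are nonzero at at least one point of $A^n$. -}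

module Defs where

open import Level using (0ℓ)
open import Data.Nat using (ℕ; zero; suc; _^_; _≤_)
import Data.Nat as ℕ
open import Data.Nat.Primality using (Prime)
open import Data.Fin using (Fin)
import Data.Fin as Fin
open import Data.Vec using (Vec; []; _∷_)
open import Data.List using (List; []; _∷_; length)
open import Data.List.Membership.Propositional using (_∈_)
open import Data.List.Relation.Unary.All using (All)
open import Data.List.Relation.Unary.Unique.Propositional using (Unique)
open import Data.Product using (_×_; _,_; Σ; ∃; proj₁; proj₂)
open import Data.Sum using (_⊎_)
open import Relation.Nullary using (¬_)
open import Relation.Binary.PropositionalEquality using (_≡_)
import Relation.Binary.PropositionalEquality as ≡
open import Relation.Binary.Construct.Closure.ReflexiveTransitive using (Star)
open import Algebra.Bundles using (CommutativeRing)
open import Function.Bundles using (Inverse)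

IsPrimePower : ℕ → Set
IsPrimePower k = Σ ℕ λ p → Σ ℕ λ e → Prime p × (k ≡ p ^ suc e)

-- Finite fields: a commutative ring which is a field, with exactly k
-- elements (a bijection between Fin k and the carrier setoid).
-- (All fields of order k are isomorphic, so this is F_k.)

module _ (R : CommutativeRing 0ℓ 0ℓ) where
  open CommutativeRing R

  IsField : Set
  IsField = (¬ (1# ≈ 0#)) × (∀ x → ¬ (x ≈ 0#) → ∃ λ y → (x * y) ≈ 1#)

  HasOrder : ℕ → Set
  HasOrder k = Inverse (≡.setoid (Fin k)) setoid

  Perm : Set
  Perm = Inverse setoid setoid

  Poly : ℕ → Set
  Poly n = List (Carrier × Vec ℕ n)

  pow : Carrier → ℕ → Carrier
  pow x zero    = 1#
  pow x (suc e) = x * pow x e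

  monomial : ∀ {n} → Vec ℕ n → (Fin n → Carrier) → Carrier
  monomial []       a = 1#
  monomial (e ∷ es) a = pow (a Fin.zero) e * monomial es (λ i → a (Fin.suc i))

  eval : ∀ {n} → Poly n → (Fin n → Carrier) → Carrier
  eval []             a = 0#
  eval ((c , e) ∷ ts) a = c * monomial e a + eval ts a

  totalDeg : ∀ {n} → Vec ℕ n → ℕ
  totalDeg []       = 0
  totalDeg (e ∷ es) = e ℕ.+ totalDeg es

  DegreeAtMost : ∀ {n} → Poly n → ℕ → Set
  DegreeAtMost f d = All (λ t → ¬ (proj₁ t ≈ 0#) → totalDeg (proj₂ t) ≤ d) f

-- Graphs on vertex set Fin n (v_{i+1} ↔ i).  A simple graph is given by
-- a duplicate-free list of edges (i , j) with i < j; this list is at the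
-- same time the canonical orientation D (arc (v_i , v_j) for i < j).

record SimpleGraph (n : ℕ) : Set where
  field
    edges    : List (Fin n × Fin n)
    ordered  : All (λ e → proj₁ e Fin.< proj₂ e) edges
    distinct : Unique edges

module _ {n : ℕ} where

  Adj : List (Fin n × Fin n) → Fin n → Fin n → Set
  Adj E u v = ((u , v) ∈ E) ⊎ ((v , u) ∈ E)

  Connected : List (Fin n × Fin n) → Set
  Connected E = ∀ u v → Star (Adj E) u v

  data Path (E : List (Fin n × Fin n)) : List (Fin n) → Set where
    single : ∀ v → Path E (v ∷ [])
    cons   : ∀ u v vs → Adj E u v → Path E (v ∷ vs) → Path E (u ∷ v ∷ vs)

  Cycle : List (Fin n × Fin n) → Set
  Cycle E = Σ (Fin n) λ u → Σ (Fin n) λ v → Σ (Fin n) λ w → Σ (List (Fin n)) λ vs →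
            Unique (u ∷ v ∷ w ∷ vs) × Path E (u ∷ v ∷ w ∷ vs)
            × Adj E (lastOf w vs) u
    where
    lastOf : Fin n → List (Fin n) → Fin n
    lastOf x []       = x
    lastOf x (y ∷ ys) = lastOf y ys

  Acyclic : List (Fin n × Fin n) → Set
  Acyclic E = ¬ Cycle E

  IsSpanningTree : SimpleGraph n → List (Fin n × Fin n) → Set
  IsSpanningTree G T = (∀ {e} → e ∈ T → e ∈ SimpleGraph.edges G)
                       × Connected T × Acyclic T

module _ (R : CommutativeRing 0ℓ 0ℓ) {n : ℕ} (G : SimpleGraph n) where
  open CommutativeRing R
  open SimpleGraph G

  -- σ assigns a permutation to each arc (i , j) of D (values on non-arcs
  -- are irrelevant)
  Labeling : Set
  Labeling = Fin n → Fin n → Perm R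

  IsProperColoring : Labeling → (Fin n → Carrier) → Set
  IsProperColoring σ κ =
    ∀ i j → (i , j) ∈ edges → ¬ (Inverse.to (σ i j) (κ i) ≈ κ j)

  Covers : Labeling → Poly R n → Set
  Covers σ f = ∀ a → ¬ (eval R f a ≈ 0#) → IsProperColoring σ a

  InF : Labeling → Poly R n → Set
  InF σ f = Covers σ f × (∃ λ a → ¬ (eval R f a ≈ 0#))

-- For k ≥ 3 take the product, over the arcs (v_i, v_j) of D, of x_i - x_j for the arcs of T and of
-- P(x_i) + x_i - x_j for the other arcs, where P interpolates x ↦ σ(x) - x. Each factor vanishes exactly
-- where σ(a_i) = a_j, so the product covers (D, σ) and is nonzero at a proper colouring. P is built from
-- the indicators 1 - (X - l)^(k-1) (Fermat), and since ∑ₓ (σ(x) - x) = 0 its coefficient of X^(k-1)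
-- vanishes, so deg P ≤ k - 2; as at least n - 1 of the arcs belong to T, the degree bound follows.
-- For k = 2 every permutation of F₂ commutes with x ↦ x + 1, so the translates of a proper colouring κ
-- are proper, and ∏_{v ≠ v₁} (x_v - x_{v₁} - κ(v) + κ(v₁) + 1), of degree n - 1, is nonzero exactly there.

module Submission where

open import Defs
open import Level using (0ℓ)
open import Data.Bool using (if_then_else_)
open import Data.Empty using (⊥; ⊥-elim)
open import Data.Nat as ℕ using (ℕ; zero; suc; _≤_; z≤n; s≤s)
import Data.Nat.Properties as ℕ
open import Data.Nat.Combinatorics using (_C_; nCn≡1)
open import Data.Nat.ListAction using (sum)
open import Data.Fin as Fin using (Fin; toℕ; fromℕ)
import Data.Fin.Properties as Fin
open import Data.Fin.Permutation using (Permutation′; _⟨$⟩ʳ_)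
open import Data.Vec as Vec using (Vec; []; _∷_)
open import Data.List as List using (List; []; _∷_; _++_; length; map; filter)
import Data.List.Properties as List
open import Data.List.Membership.Propositional using (_∈_)
open import Data.List.Membership.Propositional.Properties using (∈-filter⁺; ∈-allFin)
open import Data.List.Relation.Unary.All as All using (All; []; _∷_)
import Data.List.Relation.Unary.All.Properties as All
open import Data.List.Relation.Unary.Any using (here; there)
open import Data.Product using (_×_; _,_; Σ; ∃; proj₁; proj₂)
import Data.Product.Properties as ΣP
open import Data.Sum as Sum using (_⊎_; inj₁; inj₂)
open import Function.Base using (_∘_)
open import Function.Bundles using (Inverse)
open import Function.Definitions using (Congruent)
import Function.Construct.Composition as Comp
import Function.Construct.Symmetry as Sym
open import Relation.Nullary using (¬_; yes; no; does)
open import Relation.Unary as U using (Pred)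
open import Relation.Binary.Definitions using (Decidable)
open import Relation.Binary.PropositionalEquality as ≡ using (_≡_; _≢_)
open import Relation.Binary.Construct.Closure.ReflexiveTransitive as Star using (Star; ε; _◅_)
open import Algebra.Bundles using (CommutativeRing)
import Algebra.Properties.Semiring.Sum
import Algebra.Properties.CommutativeMonoid.Sum
open import Algebra.Properties.CommutativeSemigroup ℕ.+-commutativeSemigroup
  using () renaming (interchange to +-interchange)

module Polynomials (R : CommutativeRing 0ℓ 0ℓ) where
  open CommutativeRing R
  open import Relation.Binary.Reasoning.Setoid setoid
  open import Algebra.Properties.CommutativeSemigroup *-commutativeSemigroup using (interchange)
  open import Algebra.Properties.Ring ring using (-1*x≈-x)
  module S = Algebra.Properties.Semiring.Sum semiring

  private
    variable
      n : ℕ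

  0ᵉ : Vec ℕ n
  0ᵉ = Vec.replicate _ 0

  _+ᵉ_ : Vec ℕ n → Vec ℕ n → Vec ℕ n
  _+ᵉ_ = Vec.zipWith ℕ._+_

  varExp : Fin n → ℕ → Vec ℕ n
  varExp Fin.zero    t = t ∷ 0ᵉ
  varExp (Fin.suc i) t = 0 ∷ varExp i t

  pow-+ : ∀ x a b → pow R x (a ℕ.+ b) ≈ pow R x a * pow R x b
  pow-+ x zero    b = sym (*-identityˡ _)
  pow-+ x (suc a) b = trans (*-congˡ (pow-+ x a b)) (sym (*-assoc _ _ _))

  monomial-0ᵉ : ∀ (a : Fin n → Carrier) → monomial R 0ᵉ a ≈ 1#
  monomial-0ᵉ {zero}  a = refl
  monomial-0ᵉ {suc n} a = trans (*-identityˡ _) (monomial-0ᵉ (λ i → a (Fin.suc i)))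

  monomial-+ᵉ : ∀ (e f : Vec ℕ n) a → monomial R (e +ᵉ f) a ≈ monomial R e a * monomial R f a
  monomial-+ᵉ []      []      a = sym (*-identityˡ _)
  monomial-+ᵉ (x ∷ e) (y ∷ f) a = begin
    pow R (a Fin.zero) (x ℕ.+ y) * monomial R (e +ᵉ f) a′
      ≈⟨ *-cong (pow-+ _ x y) (monomial-+ᵉ e f a′) ⟩
    (pow R (a Fin.zero) x * pow R (a Fin.zero) y) * (monomial R e a′ * monomial R f a′)
      ≈⟨ interchange _ _ _ _ ⟩
    (pow R (a Fin.zero) x * monomial R e a′) * (pow R (a Fin.zero) y * monomial R f a′) ∎
    where a′ = λ i → a (Fin.suc i)

  monomial-varExp : ∀ (i : Fin n) t a → monomial R (varExp i t) a ≈ pow R (a i) t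
  monomial-varExp {suc n} Fin.zero t a = trans (*-congˡ (monomial-0ᵉ {n} _)) (*-identityʳ _)
  monomial-varExp (Fin.suc i) t a = trans (*-identityˡ _) (monomial-varExp i t (λ j → a (Fin.suc j)))

  totalDeg-0ᵉ : totalDeg R (0ᵉ {n}) ≡ 0
  totalDeg-0ᵉ {zero}  = ≡.refl
  totalDeg-0ᵉ {suc n} = totalDeg-0ᵉ {n}

  totalDeg-+ᵉ : ∀ (e f : Vec ℕ n) → totalDeg R (e +ᵉ f) ≡ totalDeg R e ℕ.+ totalDeg R f
  totalDeg-+ᵉ []      []      = ≡.refl
  totalDeg-+ᵉ (x ∷ e) (y ∷ f) =
    ≡.trans (≡.cong (x ℕ.+ y ℕ.+_) (totalDeg-+ᵉ e f)) (+-interchange x y _ _)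

  totalDeg-varExp : ∀ (i : Fin n) t → totalDeg R (varExp i t) ≡ t
  totalDeg-varExp {suc n} Fin.zero t = ≡.trans (≡.cong (t ℕ.+_) (totalDeg-0ᵉ {n})) (ℕ.+-identityʳ t)
  totalDeg-varExp (Fin.suc i) t = totalDeg-varExp i t

  constant : Carrier → Poly R n
  constant c = (c , 0ᵉ) ∷ []

  1ₚ : Poly R n
  1ₚ = constant 1#

  _*ₜ_ : Carrier × Vec ℕ n → Poly R n → Poly R n
  (c , e) *ₜ g = map (λ (d , f) → (c * d , e +ᵉ f)) g

  _*ₚ_ : Poly R n → Poly R n → Poly R n
  []      *ₚ g = []
  (t ∷ f) *ₚ g = t *ₜ g ++ f *ₚ g

  ∏ₚ : {A : Set} → (A → Poly R n) → List A → Poly R n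
  ∏ₚ g []       = 1ₚ
  ∏ₚ g (x ∷ xs) = g x *ₚ ∏ₚ g xs

  eval-constant : ∀ c (a : Fin n → Carrier) → eval R (constant c) a ≈ c
  eval-constant c a = trans (+-identityʳ _) (trans (*-congˡ (monomial-0ᵉ a)) (*-identityʳ c))

  eval-++ : ∀ (f g : Poly R n) a → eval R (f ++ g) a ≈ eval R f a + eval R g a
  eval-++ []            g a = sym (+-identityˡ _)
  eval-++ ((c , e) ∷ f) g a = trans (+-congˡ (eval-++ f g a)) (sym (+-assoc _ _ _))

  eval-*ₜ : ∀ c (e : Vec ℕ n) g a → eval R ((c , e) *ₜ g) a ≈ (c * monomial R e a) * eval R g a
  eval-*ₜ c e []            a = sym (zeroʳ _)
  eval-*ₜ c e ((d , f) ∷ g) a = begin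
    c * d * monomial R (e +ᵉ f) a + eval R ((c , e) *ₜ g) a
      ≈⟨ +-cong (*-congˡ (monomial-+ᵉ e f a)) (eval-*ₜ c e g a) ⟩
    c * d * (monomial R e a * monomial R f a) + (c * monomial R e a) * eval R g a
      ≈⟨ +-congʳ (interchange _ _ _ _) ⟩
    (c * monomial R e a) * (d * monomial R f a) + (c * monomial R e a) * eval R g a
      ≈⟨ sym (distribˡ _ _ _) ⟩
    (c * monomial R e a) * (d * monomial R f a + eval R g a) ∎

  eval-*ₚ : ∀ (f g : Poly R n) a → eval R (f *ₚ g) a ≈ eval R f a * eval R g a
  eval-*ₚ []            g a = sym (zeroˡ _)
  eval-*ₚ ((c , e) ∷ f) g a = begin
    eval R ((c , e) *ₜ g ++ f *ₚ g) a           ≈⟨ eval-++ ((c , e) *ₜ g) (f *ₚ g) a ⟩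
    eval R ((c , e) *ₜ g) a + eval R (f *ₚ g) a ≈⟨ +-cong (eval-*ₜ c e g a) (eval-*ₚ f g a) ⟩
    (c * monomial R e a) * eval R g a + eval R f a * eval R g a ≈⟨ sym (distribʳ _ _ _) ⟩
    (c * monomial R e a + eval R f a) * eval R g a ∎

  ∏ₚ-factor≉0 : ∀ {A : Set} (g : A → Poly R n) xs a → ¬ (eval R (∏ₚ g xs) a ≈ 0#) →
                ∀ {x} → x ∈ xs → ¬ (eval R (g x) a ≈ 0#)
  ∏ₚ-factor≉0 g (y ∷ xs) a nz (here ≡.refl) gy≈0 =
    nz (trans (eval-*ₚ (g y) (∏ₚ g xs) a) (trans (*-congʳ gy≈0) (zeroˡ _)))
  ∏ₚ-factor≉0 g (y ∷ xs) a nz (there x∈xs) = ∏ₚ-factor≉0 g xs a rest≉0 x∈xs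
    where
    rest≉0 : ¬ (eval R (∏ₚ g xs) a ≈ 0#)
    rest≉0 = λ rest≈0 → nz (trans (eval-*ₚ (g y) (∏ₚ g xs) a) (trans (*-congˡ rest≈0) (zeroʳ _)))

  linear : Fin n → Fin n → Carrier → Poly R n
  linear i j c = (1# , varExp i 1) ∷ (- 1# , varExp j 1) ∷ constant c

  eval-linear : ∀ (i j : Fin n) c a → eval R (linear i j c) a ≈ a i - a j + c
  eval-linear i j c a = begin
    1# * monomial R (varExp i 1) a + (- 1# * monomial R (varExp j 1) a + eval R (constant c) a)
      ≈⟨ +-cong (trans (*-identityˡ _) (var i))
                (+-cong (trans (-1*x≈-x _) (-‿cong (var j))) (eval-constant c a)) ⟩
    a i + (- a j + c) ≈⟨ sym (+-assoc _ _ _) ⟩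
    a i - a j + c ∎
    where
    var : ∀ i → monomial R (varExp i 1) a ≈ a i
    var i = trans (monomial-varExp i 1 a) (*-identityʳ _)

  eval-tabulate : ∀ {d} (f : Fin d → Carrier × Vec ℕ n) a →
                  eval R (List.tabulate f) a ≈ S.sum (λ t → proj₁ (f t) * monomial R (proj₂ (f t)) a)
  eval-tabulate {d = zero}  f a = refl
  eval-tabulate {d = suc d} f a = +-congˡ (eval-tabulate (λ t → f (Fin.suc t)) a)

  univariate : ∀ {d} → Fin n → (Fin d → Carrier) → Poly R n
  univariate i c = List.tabulate (λ t → c t , varExp i (toℕ t))

  eval-univariate : ∀ {d} (i : Fin n) (c : Fin d → Carrier) a →
                    eval R (univariate i c) a ≈ S.sum (λ t → c t * pow R (a i) (toℕ t))
  eval-univariate {d = d} i c a = trans (eval-tabulate (λ t → c t , varExp i (toℕ t)) a)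
                                       (S.sum-cong-≋ {d} (λ t → *-congˡ (monomial-varExp i (toℕ t) a)))

  Deg : Poly R n → ℕ → Set
  Deg = DegreeAtMost R

  deg-weaken : ∀ {f : Poly R n} {d d′} → d ≤ d′ → Deg f d → Deg f d′
  deg-weaken d≤d′ = All.map (λ bound c≉0 → ℕ.≤-trans (bound c≉0) d≤d′)

  deg-++ : ∀ {f g : Poly R n} {d} → Deg f d → Deg g d → Deg (f ++ g) d
  deg-++ []      dg = dg
  deg-++ (t ∷ df) dg = t ∷ deg-++ df dg

  deg-constant : ∀ c → Deg (constant {n} c) 0
  deg-constant {n} c = (λ _ → ℕ.≤-reflexive (totalDeg-0ᵉ {n})) ∷ []

  x*y≉0⇒x≉0 : ∀ {x y} → ¬ (x * y ≈ 0#) → ¬ (x ≈ 0#)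
  x*y≉0⇒x≉0 xy≉0 x≈0 = xy≉0 (trans (*-congʳ x≈0) (zeroˡ _))

  x*y≉0⇒y≉0 : ∀ {x y} → ¬ (x * y ≈ 0#) → ¬ (y ≈ 0#)
  x*y≉0⇒y≉0 xy≉0 y≈0 = xy≉0 (trans (*-congˡ y≈0) (zeroʳ _))

  deg-*ₜ : ∀ {c} {e : Vec ℕ n} {g d d′} → (¬ (c ≈ 0#) → totalDeg R e ≤ d) → Deg g d′ →
           Deg ((c , e) *ₜ g) (d ℕ.+ d′)
  deg-*ₜ         bound []          = []
  deg-*ₜ {c = c} {e = e} {d = d} {d′} bound (_∷_ {(c′ , e′)} bound′ dg) = term ∷ deg-*ₜ bound dg
    where
    term : ¬ (c * c′ ≈ 0#) → totalDeg R (e +ᵉ e′) ≤ d ℕ.+ d′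
    term cc′≉0 = ℕ.≤-trans (ℕ.≤-reflexive (totalDeg-+ᵉ e e′))
                           (ℕ.+-mono-≤ (bound (x*y≉0⇒x≉0 cc′≉0)) (bound′ (x*y≉0⇒y≉0 cc′≉0)))

  deg-*ₚ : ∀ {f g : Poly R n} {d d′} → Deg f d → Deg g d′ → Deg (f *ₚ g) (d ℕ.+ d′)
  deg-*ₚ []            dg = []
  deg-*ₚ (bound ∷ df) dg = deg-++ (deg-*ₜ bound dg) (deg-*ₚ df dg)

  deg-∏ₚ : ∀ {A : Set} (g : A → Poly R n) (d : A → ℕ) → (∀ x → Deg (g x) (d x)) →
           ∀ xs → Deg (∏ₚ g xs) (sum (map d xs))
  deg-∏ₚ g d dg []       = deg-constant 1#
  deg-∏ₚ g d dg (x ∷ xs) = deg-*ₚ (dg x) (deg-∏ₚ g d dg xs)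

  deg-linear : ∀ (i j : Fin n) c → Deg (linear i j c) 1
  deg-linear i j c = var i ∷ var j ∷ deg-weaken z≤n (deg-constant c)
    where
    var : ∀ i {c} → ¬ (c ≈ 0#) → totalDeg R (varExp {n} i 1) ≤ 1
    var i _ = ℕ.≤-reflexive (totalDeg-varExp i 1)

  deg-univariate : ∀ {d} (i : Fin n) (c : Fin (suc (suc d)) → Carrier) →
                   c (fromℕ (suc d)) ≈ 0# → Deg (univariate i c) d
  deg-univariate {d = d} i c top≈0 = All.tabulate⁺ {f = λ t → c t , varExp i (toℕ t)} bound
    where
    bound : ∀ t → ¬ (c t ≈ 0#) → totalDeg R (varExp i (toℕ t)) ≤ d
    bound t ct≉0 rewrite totalDeg-varExp i (toℕ t) with toℕ t ℕ.≟ suc d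
    ... | no  t≢top = ℕ.≤-pred (ℕ.≤∧≢⇒< (Fin.toℕ≤pred[n] t) t≢top)
    ... | yes t≡top = ⊥-elim (ct≉0 (trans (reflexive (≡.cong c t≡fromℕ)) top≈0))
      where
      t≡fromℕ : t ≡ fromℕ (suc d)
      t≡fromℕ = Fin.toℕ-injective (≡.trans t≡top (≡.sym (Fin.toℕ-fromℕ (suc d))))

module Field (R : CommutativeRing 0ℓ 0ℓ) (isField : IsField R) where
  open CommutativeRing R
  open Polynomials R
  open import Relation.Binary.Reasoning.Setoid setoid

  1≉0 : ¬ (1# ≈ 0#)
  1≉0 = proj₁ isField

  _⁻¹⟨_⟩ : ∀ x → ¬ (x ≈ 0#) → Carrier
  x ⁻¹⟨ x≉0 ⟩ = proj₁ (proj₂ isField x x≉0)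

  x*x⁻¹≈1 : ∀ x (x≉0 : ¬ (x ≈ 0#)) → x * x ⁻¹⟨ x≉0 ⟩ ≈ 1#
  x*x⁻¹≈1 x x≉0 = proj₂ (proj₂ isField x x≉0)

  x⁻¹*x≈1 : ∀ x (x≉0 : ¬ (x ≈ 0#)) → x ⁻¹⟨ x≉0 ⟩ * x ≈ 1#
  x⁻¹*x≈1 x x≉0 = trans (*-comm _ _) (x*x⁻¹≈1 x x≉0)

  *-cancelˡ-≉0 : ∀ {c x y} (c≉0 : ¬ (c ≈ 0#)) → c * x ≈ c * y → x ≈ y
  *-cancelˡ-≉0 {c} {x} {y} c≉0 cx≈cy = begin
    x                ≈⟨ sym (*-identityˡ x) ⟩
    1# * x           ≈⟨ *-congʳ (sym (x⁻¹*x≈1 c c≉0)) ⟩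
    (c⁻¹ * c) * x    ≈⟨ *-assoc _ _ _ ⟩
    c⁻¹ * (c * x)    ≈⟨ *-congˡ cx≈cy ⟩
    c⁻¹ * (c * y)    ≈⟨ sym (*-assoc _ _ _) ⟩
    (c⁻¹ * c) * y    ≈⟨ *-congʳ (x⁻¹*x≈1 c c≉0) ⟩
    1# * y           ≈⟨ *-identityˡ y ⟩
    y ∎
    where c⁻¹ = c ⁻¹⟨ c≉0 ⟩

  order≥2 : ∀ {k} → HasOrder R k → 2 ≤ k
  order≥2 ord = distinct⇒2≤ (Inverse.from ord 0#) (Inverse.from ord 1#)
                           (λ i0≡i1 → 1≉0 (sym (trans (sym (Inverse.strictlyInverseˡ ord 0#))
                                                      (trans (reflexive (≡.cong (Inverse.to ord) i0≡i1))
                                                             (Inverse.strictlyInverseˡ ord 1#)))))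
    where
    distinct⇒2≤ : ∀ {k} (i j : Fin k) → i ≢ j → 2 ≤ k
    distinct⇒2≤ Fin.zero    Fin.zero    i≢j = ⊥-elim (i≢j ≡.refl)
    distinct⇒2≤ Fin.zero    (Fin.suc j) _   = s≤s (ℕ.>-nonZero⁻¹ _ {{Fin.nonZeroIndex j}})
    distinct⇒2≤ (Fin.suc i) Fin.zero    _   = s≤s (ℕ.>-nonZero⁻¹ _ {{Fin.nonZeroIndex i}})
    distinct⇒2≤ (Fin.suc i) (Fin.suc j) i≢j = ℕ.m≤n⇒m≤1+n (distinct⇒2≤ i j (i≢j ∘ ≡.cong Fin.suc))

  x*y≉0 : ∀ {x y} → ¬ (x ≈ 0#) → ¬ (y ≈ 0#) → ¬ (x * y ≈ 0#)
  x*y≉0 {x} {y} x≉0 y≉0 xy≈0 = y≉0 (*-cancelˡ-≉0 x≉0 (trans xy≈0 (sym (zeroʳ x))))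

  ∏ₚ-≉0 : ∀ {n} {A : Set} (g : A → Poly R n) xs a →
          (∀ {x} → x ∈ xs → ¬ (eval R (g x) a ≈ 0#)) → ¬ (eval R (∏ₚ g xs) a ≈ 0#)
  ∏ₚ-≉0 g []       a _       = λ 1≈0 → 1≉0 (trans (sym (eval-constant 1# a)) 1≈0)
  ∏ₚ-≉0 g (x ∷ xs) a factors = λ gx*rest≈0 →
    x*y≉0 (factors (here ≡.refl)) (∏ₚ-≉0 g xs a (λ x∈xs → factors (there x∈xs)))
          (trans (sym (eval-*ₚ (g x) (∏ₚ g xs) a)) gx*rest≈0)

module FiniteField (R : CommutativeRing 0ℓ 0ℓ) (isField : IsField R) {N : ℕ} (ord : HasOrder R (suc N)) where
  open CommutativeRing R
  open Polynomials R
  open Field R isField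
  open import Relation.Binary.Reasoning.Setoid setoid
  open import Algebra.Properties.Ring ring using (-‿+-comm; -0#≈0#)
  module Π = Algebra.Properties.CommutativeMonoid.Sum *-commutativeMonoid

  element : Fin (suc N) → Carrier
  element = Inverse.to ord

  index : Carrier → Fin (suc N)
  index = Inverse.from ord

  index-injective : ∀ {x y} → index x ≡ index y → x ≈ y
  index-injective {x} {y} ix≡iy = begin
    x                 ≈⟨ sym (Inverse.strictlyInverseˡ ord x) ⟩
    element (index x) ≡⟨ ≡.cong element ix≡iy ⟩
    element (index y) ≈⟨ Inverse.strictlyInverseˡ ord y ⟩
    y                 ∎

  _≟_ : Decidable _≈_
  x ≟ y with index x Fin.≟ index y
  ... | yes ix≡iy = yes (index-injective ix≡iy)
  ... | no  ix≢iy = no (λ x≈y → ix≢iy (Inverse.from-cong ord x≈y))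

  ∑ : (Carrier → Carrier) → Carrier
  ∑ f = S.sum (λ l → f (element l))

  ∏ : (Carrier → Carrier) → Carrier
  ∏ f = Π.sum (λ l → f (element l))

  reindex : Perm R → Permutation′ (suc N)
  reindex π = Comp.inverse (Comp.inverse ord π) (Sym.inverse ord)

  element-reindex : ∀ π l → element (reindex π ⟨$⟩ʳ l) ≈ Inverse.to π (element l)
  element-reindex π l = Inverse.strictlyInverseˡ ord _

  ∑-permute : ∀ f → Congruent _≈_ _≈_ f → (π : Perm R) → ∑ f ≈ ∑ (λ x → f (Inverse.to π x))
  ∑-permute f f-cong π = trans (S.∑-permute (λ l → f (element l)) (reindex π))
                               (S.sum-cong-≋ (λ l → f-cong (element-reindex π l)))

  ∏-permute : ∀ f → Congruent _≈_ _≈_ f → (π : Perm R) → ∏ f ≈ ∏ (λ x → f (Inverse.to π x))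
  ∏-permute f f-cong π = trans (Π.∑-permute (λ l → f (element l)) (reindex π))
                               (Π.sum-cong-≋ (λ l → f-cong (element-reindex π l)))

  ∏-const : ∀ {m} (f : Fin m → Carrier) {c} → (∀ i → f i ≈ c) → Π.sum f ≈ pow R c m
  ∏-const {zero}  f f≈c = refl
  ∏-const {suc m} f f≈c = *-cong (f≈c Fin.zero) (∏-const (λ i → f (Fin.suc i)) (λ i → f≈c (Fin.suc i)))

  element≉0 : ∀ {l} → l ≢ index 0# → ¬ (element l ≈ 0#)
  element≉0 {l} l≢0 el≈0 =
    l≢0 (≡.trans (≡.sym (Inverse.strictlyInverseʳ ord l)) (Inverse.from-cong ord el≈0))

  scaling : ∀ c → ¬ (c ≈ 0#) → Perm R
  scaling c c≉0 = record
    { to        = c *_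
    ; from      = c⁻¹ *_
    ; to-cong   = *-congˡ
    ; from-cong = *-congˡ
    ; inverse   = (λ {x} y≈c⁻¹x → trans (*-congˡ y≈c⁻¹x) (cancel c c⁻¹ x (x*x⁻¹≈1 c c≉0)))
                , (λ {x} y≈cx → trans (*-congˡ y≈cx) (cancel c⁻¹ c x (x⁻¹*x≈1 c c≉0)))
    }
    where
    c⁻¹ = c ⁻¹⟨ c≉0 ⟩
    cancel : ∀ a b x → a * b ≈ 1# → a * (b * x) ≈ x
    cancel a b x ab≈1 = trans (sym (*-assoc a b x)) (trans (*-congʳ ab≈1) (*-identityˡ x))

  ifZero : Carrier → Carrier → Carrier → Carrier
  ifZero y a b with y ≟ 0#
  ... | yes _ = a
  ... | no  _ = b

  ifZero-≈0 : ∀ {y} a b → y ≈ 0# → ifZero y a b ≈ a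
  ifZero-≈0 {y} a b y≈0 with y ≟ 0#
  ... | yes _   = refl
  ... | no  y≉0 = ⊥-elim (y≉0 y≈0)

  ifZero-≉0 : ∀ {y} a b → ¬ (y ≈ 0#) → ifZero y a b ≈ b
  ifZero-≉0 {y} a b y≉0 with y ≟ 0#
  ... | yes y≈0 = ⊥-elim (y≉0 y≈0)
  ... | no  _   = refl

  fermat : ∀ c → ¬ (c ≈ 0#) → pow R c N ≈ 1#
  fermat c c≉0 = sym (*-cancelˡ-≉0 ∏unit≉0 (begin
    ∏ unit * 1#                 ≈⟨ *-identityʳ _ ⟩
    ∏ unit                      ≈⟨ ∏-permute unit unit-cong (scaling c c≉0) ⟩
    ∏ (λ y → unit (c * y))      ≈⟨ Π.sum-cong-≋ (λ l → unit-scaled (element l)) ⟩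
    ∏ (λ y → factor y * unit y) ≈⟨ Π.∑-distrib-+ (λ l → factor (element l)) (λ l → unit (element l)) ⟩
    ∏ factor * ∏ unit           ≈⟨ *-congʳ ∏factor≈c^N ⟩
    pow R c N * ∏ unit          ≈⟨ *-comm _ _ ⟩
    ∏ unit * pow R c N          ∎))
    where
    -- 0 is replaced by 1, so that ∏ unit is the product of the units and is nonzero
    unit : Carrier → Carrier
    unit y = ifZero y 1# y

    factor : Carrier → Carrier
    factor y = ifZero y 1# c

    unit≉0 : ∀ y → ¬ (unit y ≈ 0#)
    unit≉0 y with y ≟ 0#
    ... | yes _   = 1≉0
    ... | no  y≉0 = y≉0

    unit-cong : Congruent _≈_ _≈_ unit
    unit-cong {y} {y′} y≈y′ with y ≟ 0#
    ... | yes y≈0 = sym (ifZero-≈0 1# y′ (trans (sym y≈y′) y≈0))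
    ... | no  y≉0 = trans y≈y′ (sym (ifZero-≉0 1# y′ (λ y′≈0 → y≉0 (trans y≈y′ y′≈0))))

    unit-scaled : ∀ y → unit (c * y) ≈ factor y * unit y
    unit-scaled y with y ≟ 0#
    ... | yes y≈0 = trans (ifZero-≈0 1# _ (trans (*-congˡ y≈0) (zeroʳ c))) (sym (*-identityˡ 1#))
    ... | no  y≉0 = ifZero-≉0 1# _ (x*y≉0 c≉0 y≉0)

    ∏unit≉0 : ¬ (∏ unit ≈ 0#)
    ∏unit≉0 = product≉0 (λ l → unit≉0 (element l))
      where
      product≉0 : ∀ {m} {f : Fin m → Carrier} → (∀ i → ¬ (f i ≈ 0#)) → ¬ (Π.sum f ≈ 0#)
      product≉0 {zero}  _   = 1≉0
      product≉0 {suc m} f≉0 = x*y≉0 (f≉0 Fin.zero) (product≉0 (λ i → f≉0 (Fin.suc i)))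

    ∏factor≈c^N : ∏ factor ≈ pow R c N
    ∏factor≈c^N = begin
      ∏ factor                        ≈⟨ Π.sum-remove {i = index 0#} (λ l → factor (element l)) ⟩
      factor (element (index 0#)) * _ ≈⟨ *-cong at-0 (∏-const _ at-units) ⟩
      1# * pow R c N                  ≈⟨ *-identityˡ _ ⟩
      pow R c N                       ∎
      where
      at-0 : factor (element (index 0#)) ≈ 1#
      at-0 = ifZero-≈0 1# c (Inverse.strictlyInverseˡ ord 0#)
      at-units : ∀ j → factor (element (Fin.punchIn (index 0#) j)) ≈ c
      at-units j = ifZero-≉0 1# c (element≉0 (Fin.punchInᵢ≢i (index 0#) j))

  sum-neg : ∀ {m} (f : Fin m → Carrier) → S.sum (λ i → - f i) ≈ - S.sum f
  sum-neg {zero}  f = sym -0#≈0#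
  sum-neg {suc m} f = trans (+-congˡ (sum-neg (λ i → f (Fin.suc i)))) (-‿+-comm _ _)

  displacement : Perm R → Carrier → Carrier
  displacement π x = Inverse.to π x - x

  displacement-cong : ∀ π → Congruent _≈_ _≈_ (displacement π)
  displacement-cong π x≈y = +-cong (Inverse.to-cong π x≈y) (-‿cong x≈y)

  ∑-displacement : (π : Perm R) → ∑ (displacement π) ≈ 0#
  ∑-displacement π = begin
    ∑ (displacement π)
      ≈⟨ S.∑-distrib-+ (λ l → Inverse.to π (element l)) (λ l → - element l) ⟩
    ∑ (Inverse.to π) + S.sum (λ l → - element l)
      ≈⟨ +-cong (sym (∑-permute (λ x → x) (λ x≈y → x≈y) π)) (sum-neg element) ⟩
    ∑ (λ x → x) - ∑ (λ x → x)
      ≈⟨ -‿inverseʳ _ ⟩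
    0# ∎

module Interpolation
  (R : CommutativeRing 0ℓ 0ℓ) (isField : IsField R) {d : ℕ} (ord : HasOrder R (suc (suc d))) where
  open CommutativeRing R
  open Polynomials R
  open FiniteField R isField ord
  open import Relation.Binary.Reasoning.Setoid setoid
  open import Algebra.Properties.Ring ring
    using (x[y-z]≈xy-xz; -‿distribˡ-*; -0#≈0#; x≈y⇒x∙y⁻¹≈ε; x∙y⁻¹≈ε⇒x≈y)
  open import Algebra.Properties.Semiring.Exp semiring using (_^_)
  open import Algebra.Properties.Semiring.Mult semiring using (×-assoc-*; ×-congʳ) renaming (_×_ to _⊠_)
  open import Algebra.Properties.CommutativeSemiring.Binomial commutativeSemiring using (binomialTerm; theorem)

  private
    N = suc d
    variable
      n : ℕ

  pow≈^ : ∀ x e → pow R x e ≈ x ^ e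
  pow≈^ x zero    = refl
  pow≈^ x (suc e) = *-congˡ (pow≈^ x e)

  indicator-≈ : ∀ {X l} → X ≈ l → 1# - pow R (X - l) N ≈ 1#
  indicator-≈ {X} {l} X≈l = begin
    1# - pow R (X - l) N ≈⟨ +-congˡ (-‿cong (trans (*-congʳ (x≈y⇒x∙y⁻¹≈ε X≈l)) (zeroˡ _))) ⟩
    1# - 0#              ≈⟨ +-congˡ -0#≈0# ⟩
    1# + 0#              ≈⟨ +-identityʳ 1# ⟩
    1#                   ∎

  indicator-≉ : ∀ {X l} → ¬ (X ≈ l) → 1# - pow R (X - l) N ≈ 0#
  indicator-≉ {X} {l} X≉l = begin
    1# - pow R (X - l) N ≈⟨ +-congˡ (-‿cong (fermat (X - l) (X≉l ∘ x∙y⁻¹≈ε⇒x≈y X l))) ⟩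
    1# - 1#              ≈⟨ -‿inverseʳ 1# ⟩
    0#                   ∎

  sum-≈0 : ∀ {m} (f : Fin m → Carrier) → (∀ i → f i ≈ 0#) → S.sum f ≈ 0#
  sum-≈0 {m} f f≈0 = trans (S.sum-cong-≋ f≈0) (S.sum-replicate-zero m)

  lagrange : ∀ w → Congruent _≈_ _≈_ w → ∀ X → ∑ (λ l → w l * (1# - pow R (X - l) N)) ≈ w X
  lagrange w w-cong X = begin
    S.sum term                                      ≈⟨ S.sum-remove {i = index X} term ⟩
    term (index X) + S.sum (λ j → term (Fin.punchIn (index X) j))
      ≈⟨ +-cong at-X (sum-≈0 _ (λ j → elsewhere (Fin.punchInᵢ≢i (index X) j))) ⟩
    w X + 0#                                        ≈⟨ +-identityʳ _ ⟩
    w X                                             ∎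
    where
    term : Fin (suc N) → Carrier
    term i = w (element i) * (1# - pow R (X - element i) N)
    X≈element : X ≈ element (index X)
    X≈element = sym (Inverse.strictlyInverseˡ ord X)
    at-X : term (index X) ≈ w X
    at-X = trans (*-cong (w-cong (sym X≈element)) (indicator-≈ X≈element)) (*-identityʳ _)
    elsewhere : ∀ {i} → i ≢ index X → term i ≈ 0#
    elsewhere {i} i≢X = trans (*-congˡ (indicator-≉ X≉i)) (zeroʳ _)
      where
      X≉i : ¬ (X ≈ element i)
      X≉i X≈i = i≢X (≡.trans (≡.sym (Inverse.strictlyInverseʳ ord i)) (Inverse.from-cong ord (sym X≈i)))

  binomialWeight : Carrier → Fin (suc N) → Carrier
  binomialWeight l t = (N C toℕ t) ⊠ pow R (- l) (N ℕ.∸ toℕ t)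

  -- the coefficient of X ^ t in ∑ₗ v l * (X - l) ^ N
  coefficient : (Carrier → Carrier) → Fin (suc N) → Carrier
  coefficient v t = ∑ (λ l → v l * binomialWeight l t)

  binomial-expansion : ∀ v X →
                       S.sum (λ t → coefficient v t * pow R X (toℕ t)) ≈ ∑ (λ l → v l * pow R (X - l) N)
  binomial-expansion v X = begin
    S.sum (λ t → S.sum (λ l → A l t) * Xᵗ t)  ≈⟨ S.sum-cong-≋ {suc N} (λ t → S.*-distribʳ-sum (Xᵗ t) (A′ t)) ⟩
    S.sum (λ t → S.sum (λ l → A l t * Xᵗ t)) ≈⟨ S.∑-comm (λ t l → A l t * Xᵗ t) ⟩
    S.sum (λ l → S.sum (λ t → A l t * Xᵗ t)) ≈⟨ S.sum-cong-≋ {suc N} (λ l → expand (element l)) ⟩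
    ∑ (λ l → v l * pow R (X - l) N)         ∎
    where
    Xᵗ : Fin (suc N) → Carrier
    Xᵗ t = pow R X (toℕ t)

    A : Fin (suc N) → Fin (suc N) → Carrier
    A l t = v (element l) * binomialWeight (element l) t

    A′ : Fin (suc N) → Fin (suc N) → Carrier
    A′ t l = A l t

    expand : ∀ l → S.sum (λ t → v l * binomialWeight l t * Xᵗ t) ≈ v l * pow R (X - l) N
    expand l = begin
      S.sum (λ t → v l * binomialWeight l t * Xᵗ t) ≈⟨ S.sum-cong-≋ {suc N} term ⟩
      S.sum (λ t → v l * binomialTerm X (- l) N t) ≈⟨ S.*-distribˡ-sum (v l) (binomialTerm X (- l) N) ⟨
      v l * S.sum (binomialTerm X (- l) N)         ≈⟨ *-congˡ (theorem N X (- l)) ⟨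
      v l * (X - l) ^ N                            ≈⟨ *-congˡ (pow≈^ (X - l) N) ⟨
      v l * pow R (X - l) N                        ∎
      where
      term : ∀ t → v l * binomialWeight l t * Xᵗ t ≈ v l * binomialTerm X (- l) N t
      term t = trans (*-assoc (v l) _ _) (*-congˡ (trans (×-assoc-* (N C toℕ t) _ _) (×-congʳ (N C toℕ t)
                 (trans (*-comm _ _) (*-cong (pow≈^ X (toℕ t)) (pow≈^ (- l) (N ℕ.∸ toℕ t)))))))

  interpolant : Fin n → (Carrier → Carrier) → Poly R n
  interpolant i w = constant (∑ w) ++ univariate i (coefficient (λ l → - w l))

  eval-interpolant : ∀ w → Congruent _≈_ _≈_ w → ∀ (i : Fin n) a → eval R (interpolant i w) a ≈ w (a i)
  eval-interpolant w w-cong i a = begin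
    eval R (constant (∑ w) ++ univariate i (coefficient -w)) a
      ≈⟨ eval-++ (constant (∑ w)) (univariate i (coefficient -w)) a ⟩
    eval R (constant (∑ w)) a + eval R (univariate i (coefficient -w)) a
      ≈⟨ +-cong (eval-constant (∑ w) a) (eval-univariate i (coefficient -w) a) ⟩
    ∑ w + S.sum (λ t → coefficient -w t * pow R X (toℕ t))
      ≈⟨ +-congˡ (binomial-expansion -w X) ⟩
    ∑ w + ∑ (λ l → - w l * pow R (X - l) N)
      ≈⟨ S.∑-distrib-+ (λ l → w (element l)) (λ l → - w (element l) * pow R (X - element l) N) ⟨
    ∑ (λ l → w l + - w l * pow R (X - l) N)
      ≈⟨ S.sum-cong-≋ {suc N} (λ l → x+-x*p≈x*[1-p] (w (element l)) (pow R (X - element l) N)) ⟩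
    ∑ (λ l → w l * (1# - pow R (X - l) N))
      ≈⟨ lagrange w w-cong X ⟩
    w X ∎
    where
    X = a i
    -w = λ l → - w l
    x+-x*p≈x*[1-p] : ∀ x p → x + - x * p ≈ x * (1# - p)
    x+-x*p≈x*[1-p] x p = sym (trans (x[y-z]≈xy-xz x 1# p) (+-cong (*-identityʳ x) (-‿distribˡ-* x p)))

  deg-interpolant : ∀ w → ∑ w ≈ 0# → ∀ (i : Fin n) → Deg (interpolant i w) d
  deg-interpolant w ∑w≈0 i =
    deg-++ (deg-weaken z≤n (deg-constant (∑ w))) (deg-univariate i (coefficient (λ l → - w l)) top≈0)
    where
    top-weight : ∀ l → binomialWeight l (fromℕ N) ≈ 1#
    top-weight l = ≡.subst (λ m → (N C m) ⊠ pow R (- l) (N ℕ.∸ m) ≈ 1#) (≡.sym (Fin.toℕ-fromℕ N))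
      (trans (reflexive (≡.cong₂ (λ c e → c ⊠ pow R (- l) e) (nCn≡1 N) (ℕ.n∸n≡0 N))) (+-identityʳ 1#))

    top≈0 : coefficient (λ l → - w l) (fromℕ N) ≈ 0#
    top≈0 = begin
      coefficient (λ l → - w l) (fromℕ N)
        ≈⟨ S.sum-cong-≋ {suc N} (λ l → trans (*-congˡ (top-weight (element l))) (*-identityʳ (- w (element l)))) ⟩
      ∑ (λ l → - w l) ≈⟨ sum-neg (λ l → w (element l)) ⟩
      - ∑ w           ≈⟨ -‿cong ∑w≈0 ⟩
      - 0#            ≈⟨ -0#≈0# ⟩
      0#              ∎

module Connectivity where
  open import Data.Nat using (_+_; _∸_)

  private
    variable
      n : ℕ

  count : {P : Pred (Fin n) 0ℓ} → U.Decidable P → ℕ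
  count {zero}  P? = 0
  count {suc n} P? with P? Fin.zero
  ... | yes _ = suc (count (λ i → P? (Fin.suc i)))
  ... | no  _ = count (λ i → P? (Fin.suc i))

  count-mono : {P Q : Pred (Fin n) 0ℓ} (P? : U.Decidable P) (Q? : U.Decidable Q) →
               (∀ i → P i → Q i) → count P? ≤ count Q?
  count-mono {zero}  P? Q? P⊆Q = z≤n
  count-mono {suc n} P? Q? P⊆Q with P? Fin.zero | Q? Fin.zero
  ... | yes _  | yes _  = s≤s (count-mono _ _ (P⊆Q ∘ Fin.suc))
  ... | yes p₀ | no ¬q₀ = ⊥-elim (¬q₀ (P⊆Q Fin.zero p₀))
  ... | no _   | yes _  = ℕ.m≤n⇒m≤1+n (count-mono _ _ (P⊆Q ∘ Fin.suc))
  ... | no _   | no _   = count-mono _ _ (P⊆Q ∘ Fin.suc)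

  count-all : {P : Pred (Fin n) 0ℓ} (P? : U.Decidable P) → (∀ i → P i) → n ≤ count P?
  count-all {zero}  P? all = z≤n
  count-all {suc n} P? all with P? Fin.zero
  ... | yes _  = s≤s (count-all _ (all ∘ Fin.suc))
  ... | no ¬p₀ = ⊥-elim (¬p₀ (all Fin.zero))

  count-none : {P : Pred (Fin n) 0ℓ} (P? : U.Decidable P) → (∀ i → ¬ P i) → count P? ≡ 0
  count-none {zero}  P? none = ≡.refl
  count-none {suc n} P? none with P? Fin.zero
  ... | yes p₀ = ⊥-elim (none Fin.zero p₀)
  ... | no _   = count-none _ (none ∘ Fin.suc)

  count-mono-except : {P Q : Pred (Fin n) 0ℓ} (P? : U.Decidable P) (Q? : U.Decidable Q) (i₀ : Fin n) →
                      (∀ i → i ≢ i₀ → P i → Q i) → count P? ≤ suc (count Q?)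
  count-mono-except P? Q? Fin.zero P⊆Q
    with P? Fin.zero | Q? Fin.zero | count-mono (P? ∘ Fin.suc) (Q? ∘ Fin.suc) (λ i → P⊆Q (Fin.suc i) (λ ()))
  ... | yes _ | yes _ | tail≤ = s≤s (ℕ.m≤n⇒m≤1+n tail≤)
  ... | yes _ | no _  | tail≤ = s≤s tail≤
  ... | no _  | yes _ | tail≤ = ℕ.m≤n⇒m≤1+n (ℕ.m≤n⇒m≤1+n tail≤)
  ... | no _  | no _  | tail≤ = ℕ.m≤n⇒m≤1+n tail≤
  count-mono-except P? Q? (Fin.suc i₀) P⊆Q
    with P? Fin.zero | Q? Fin.zero
       | count-mono-except (P? ∘ Fin.suc) (Q? ∘ Fin.suc) i₀ (λ i → P⊆Q (Fin.suc i) ∘ (_∘ Fin.suc-injective))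
  ... | yes _  | yes _  | tail≤ = s≤s tail≤
  ... | yes p₀ | no ¬q₀ | _     = ⊥-elim (¬q₀ (P⊆Q Fin.zero (λ ()) p₀))
  ... | no _   | yes _  | tail≤ = ℕ.m≤n⇒m≤1+n tail≤
  ... | no _   | no _   | tail≤ = tail≤

  merge : (Fin n → Fin n) → Fin n → Fin n → Fin n → Fin n
  merge L a b x with L x Fin.≟ L b
  ... | yes _ = L a
  ... | no  _ = L x

  component : List (Fin n × Fin n) → Fin n → Fin n
  component []             = λ x → x
  component ((a , b) ∷ E) = merge (component E) a b

  merge-joins : ∀ L (a b : Fin n) → merge L a b a ≡ merge L a b b
  merge-joins L a b with L a Fin.≟ L b | L b Fin.≟ L b
  ... | _     | no Lb≢Lb = ⊥-elim (Lb≢Lb ≡.refl)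
  ... | yes _ | yes _    = ≡.refl
  ... | no _  | yes _    = ≡.refl

  merge-preserves : ∀ L (a b : Fin n) {u v} → L u ≡ L v → merge L a b u ≡ merge L a b v
  merge-preserves L a b {u} {v} Lu≡Lv with L u Fin.≟ L b | L v Fin.≟ L b
  ... | yes _   | yes _   = ≡.refl
  ... | yes u~b | no  v≁b = ⊥-elim (v≁b (≡.trans (≡.sym Lu≡Lv) u~b))
  ... | no  u≁b | yes v~b = ⊥-elim (u≁b (≡.trans Lu≡Lv v~b))
  ... | no  _   | no  _   = Lu≡Lv

  merge-other : ∀ L (a b : Fin n) {x} → L x ≢ L b → merge L a b x ≡ L x
  merge-other L a b {x} x≁b with L x Fin.≟ L b
  ... | yes x~b = ⊥-elim (x≁b x~b)
  ... | no  _   = ≡.refl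

  component-edge : ∀ E {u v : Fin n} → (u , v) ∈ E → component E u ≡ component E v
  component-edge ((a , b) ∷ E) (here ≡.refl) = merge-joins (component E) a b
  component-edge ((a , b) ∷ E) (there uv∈E)  = merge-preserves (component E) a b (component-edge E uv∈E)

  component-path : ∀ E {u v : Fin n} → Star (Adj E) u v → component E u ≡ component E v
  component-path E ε                 = ≡.refl
  component-path E (inj₁ uw∈E ◅ wv) = ≡.trans (component-edge E uw∈E) (component-path E wv)
  component-path E (inj₂ wu∈E ◅ wv) = ≡.trans (≡.sym (component-edge E wu∈E)) (component-path E wv)

  connected-mono : ∀ {E F : List (Fin n × Fin n)} → (∀ {e} → e ∈ E → e ∈ F) → Connected E → Connected F
  connected-mono E⊆F connected u v = Star.map (Sum.map E⊆F E⊆F) (connected u v)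

  Label : (Fin n → Fin n) → Pred (Fin n) 0ℓ
  Label L c = ∃ λ x → L x ≡ c

  label? : (L : Fin n → Fin n) → U.Decidable (Label L)
  label? L c = Fin.any? (λ x → L x Fin.≟ c)

  open ℕ.≤-Reasoning

  -- each edge lowers the number of labels by at most one
  n≤length+#labels : ∀ (E : List (Fin n × Fin n)) → n ≤ length E + count (label? (component E))
  n≤length+#labels [] = count-all (label? (λ x → x)) (λ c → c , ≡.refl)
  n≤length+#labels ((a , b) ∷ E) = ℕ.≤-trans (n≤length+#labels E) (begin
    length E + count (label? L)                   ≤⟨ ℕ.+-monoʳ-≤ (length E) (count-mono-except _ _ (L b) kept) ⟩
    length E + suc (count (label? (merge L a b))) ≡⟨ ℕ.+-suc (length E) _ ⟩
    suc (length E) + count (label? (merge L a b)) ∎)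
    where
    L = component E
    kept : ∀ c → c ≢ L b → Label L c → Label (merge L a b) c
    kept c c≢Lb (x , Lx≡c) = x , ≡.trans (merge-other L a b (c≢Lb ∘ ≡.trans (≡.sym Lx≡c))) Lx≡c

  connected⇒n∸1≤length : ∀ (E : List (Fin n × Fin n)) → Connected E → n ∸ 1 ≤ length E
  connected⇒n∸1≤length {zero}  E _         = z≤n
  connected⇒n∸1≤length {suc n} E connected = ℕ.+-cancelʳ-≤ 1 n (length E) (begin
    n + 1                    ≡⟨ ℕ.+-comm n 1 ⟩
    suc n                    ≤⟨ n≤length+#labels E ⟩
    length E + count labels? ≤⟨ ℕ.+-monoʳ-≤ (length E) #labels≤1 ⟩
    length E + 1             ∎)
    where
    labels? = label? (component E)
    none? : U.Decidable (λ (_ : Fin (suc n)) → ⊥)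
    none? _ = no (λ ())
    #labels≤1 : count labels? ≤ 1
    #labels≤1 = begin
      count labels?      ≤⟨ count-mono-except labels? none? (component E Fin.zero) only-one ⟩
      suc (count none?)  ≡⟨ ≡.cong suc (count-none none? (λ _ ())) ⟩
      1                  ∎
      where
      only-one : ∀ c → c ≢ component E Fin.zero → Label (component E) c → ⊥
      only-one c c≢c₀ (x , x↦c) = c≢c₀ (≡.trans (≡.sym x↦c) (component-path E (connected x Fin.zero)))

module DegreeArithmetic where
  open import Data.Nat using (_+_; _*_; _∸_)
  open import Data.Nat.Solver using (module +-*-Solver)
  open +-*-Solver
  open ℕ.≤-Reasoning

  m≤[n∸1]+[m+1∸n] : ∀ m n → m ≤ (n ∸ 1) + (m + 1 ∸ n)
  m≤[n∸1]+[m+1∸n] m zero    = ℕ.m≤m+n m 1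
  m≤[n∸1]+[m+1∸n] m (suc n) rewrite ℕ.+-comm m 1 = ℕ.m≤n+m∸n m n

  -- c is the total weight of m items, t of weight 1 and the others of weight K ≥ 1;
  -- with only s ≤ t items of weight 1 the total can only grow
  exchange : ∀ K .{{_ : ℕ.NonZero K}} {c t m s} → c + K * t ≡ K * m + t → s ≤ t → c + K * s ≤ K * m + s
  exchange K {c} {t} {m} {s} eq s≤t = ℕ.+-cancelʳ-≤ d (c + K * s) (K * m + s) (begin
    c + K * s + d      ≤⟨ ℕ.+-monoʳ-≤ (c + K * s) (ℕ.m≤n*m d K) ⟩
    c + K * s + K * d  ≡⟨ solve 4 (λ c K s d → c :+ K :* s :+ K :* d := c :+ K :* (s :+ d)) ≡.refl c K s d ⟩
    c + K * (s + d)    ≡⟨ ≡.cong (λ t → c + K * t) s+d≡t ⟩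
    c + K * t          ≡⟨ eq ⟩
    K * m + t          ≡⟨ ≡.cong (K * m +_) (≡.sym s+d≡t) ⟩
    K * m + (s + d)    ≡⟨ ≡.sym (ℕ.+-assoc (K * m) s d) ⟩
    K * m + s + d      ∎)
    where
    d = t ∸ s
    s+d≡t : s + d ≡ t
    s+d≡t = ℕ.m+[n∸m]≡n s≤t

  cost-bound : ∀ K .{{_ : ℕ.NonZero K}} {c t} m n → c + K * t ≡ K * m + t → n ∸ 1 ≤ t →
               c ≤ K * (m + 1 ∸ n) + (n ∸ 1)
  cost-bound K {c} m n eq s≤t = ℕ.+-cancelʳ-≤ (K * s) c (K * r + s) (begin
    c + K * s          ≤⟨ exchange K eq s≤t ⟩
    K * m + s          ≤⟨ ℕ.+-monoˡ-≤ s (ℕ.*-monoʳ-≤ K (m≤[n∸1]+[m+1∸n] m n)) ⟩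
    K * (s + r) + s    ≡⟨ solve 3 (λ K s r → K :* (s :+ r) :+ s := K :* r :+ s :+ K :* s) ≡.refl K s r ⟩
    K * r + s + K * s  ∎)
    where
    s = n ∸ 1
    r = m + 1 ∸ n

  module _ {A : Set} {P : Pred A 0ℓ} (P? : U.Decidable P) (K : ℕ) where

    weight : A → ℕ
    weight x = if does (P? x) then 1 else K

    sum-weight : ∀ xs → sum (map weight xs) + K * length (filter P? xs) ≡ K * length xs + length (filter P? xs)
    sum-weight []       = ≡.sym (ℕ.+-identityʳ (K * 0))
    sum-weight (x ∷ xs) with P? x
    ... | yes _ = begin-equality
      suc (S + K * suc f) ≡⟨ solve 3 (λ S K f → con 1 :+ S :+ K :* (con 1 :+ f) := S :+ K :* f :+ (con 1 :+ K))
                                     ≡.refl S K f ⟩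
      S + K * f + suc K   ≡⟨ ≡.cong (_+ suc K) (sum-weight xs) ⟩
      K * l + f + suc K   ≡⟨ solve 3 (λ K l f → K :* l :+ f :+ (con 1 :+ K) := K :* (con 1 :+ l) :+ (con 1 :+ f))
                                     ≡.refl K l f ⟩
      K * suc l + suc f   ∎
      where
      S = sum (map weight xs)
      f = length (filter P? xs)
      l = length xs
    ... | no  _ = begin-equality
      K + S + K * f       ≡⟨ solve 3 (λ S K f → K :+ S :+ K :* f := S :+ K :* f :+ K) ≡.refl S K f ⟩
      S + K * f + K       ≡⟨ ≡.cong (_+ K) (sum-weight xs) ⟩
      K * l + f + K       ≡⟨ solve 3 (λ K l f → K :* l :+ f :+ K := K :* (con 1 :+ l) :+ f) ≡.refl K l f ⟩
      K * suc l + f       ∎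
      where
      S = sum (map weight xs)
      f = length (filter P? xs)
      l = length xs

module Covering
  (R : CommutativeRing 0ℓ 0ℓ) (isField : IsField R) {n : ℕ} (G : SimpleGraph n) (σ : Labeling R G) where
  open CommutativeRing R
  open Polynomials R
  open Field R isField
  open SimpleGraph G
  open import Algebra.Properties.Ring ring using (x≈y⇒x∙y⁻¹≈ε; x∙y⁻¹≈ε⇒x≈y)

  Represents : Fin n → Fin n → Poly R n → Set
  Represents i j g = ∀ a → eval R g a ≈ Inverse.to (σ i j) (a i) - a j

  ∏ₚ-InF : (g : Fin n × Fin n → Poly R n) → (∀ {i j} → (i , j) ∈ edges → Represents i j (g (i , j))) →
           ∀ κ → IsProperColoring R G σ κ → InF R G σ (∏ₚ g edges)
  ∏ₚ-InF g represents κ κ-proper = covers , κ , nonzero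
    where
    covers : Covers R G σ (∏ₚ g edges)
    covers a f≉0 i j ij∈E σai≈aj =
      ∏ₚ-factor≉0 g edges a f≉0 ij∈E (trans (represents ij∈E a) (x≈y⇒x∙y⁻¹≈ε σai≈aj))
    nonzero : ¬ (eval R (∏ₚ g edges) κ ≈ 0#)
    nonzero = ∏ₚ-≉0 g edges κ λ {(i , j)} ij∈E gκ≈0 →
      κ-proper i j ij∈E (x∙y⁻¹≈ε⇒x≈y _ _ (trans (sym (represents ij∈E κ)) gκ≈0))

module SpanningTreeConstruction
  (R : CommutativeRing 0ℓ 0ℓ) (isField : IsField R) {d : ℕ} .{{_ : ℕ.NonZero d}} (ord : HasOrder R (suc (suc d)))
  {n : ℕ} (G : SimpleGraph n) (T : List (Fin n × Fin n)) (σ : Labeling R G)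
  (σ-tree : ∀ i j → (i , j) ∈ T → ∀ x → CommutativeRing._≈_ R (Inverse.to (σ i j) x) x)
  where
  open CommutativeRing R
  open Polynomials R
  open FiniteField R isField ord
  open Interpolation R isField ord
  open Covering R isField G σ
  open Connectivity using (connected-mono; connected⇒n∸1≤length)
  open DegreeArithmetic using (cost-bound; weight; sum-weight)
  open SimpleGraph G
  open import Relation.Binary.Reasoning.Setoid setoid
  open import Data.List.Membership.DecPropositional (ΣP.≡-dec (Fin._≟_ {n}) (Fin._≟_ {n})) using (_∈?_)

  edgeFactor : Fin n × Fin n → Poly R n
  edgeFactor (i , j) with (i , j) ∈? T
  ... | yes _ = linear i j 0#
  ... | no  _ = interpolant i (displacement (σ i j)) ++ linear i j 0#

  eval-linear-0 : ∀ (i j : Fin n) a → eval R (linear i j 0#) a ≈ a i - a j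
  eval-linear-0 i j a = trans (eval-linear i j 0# a) (+-identityʳ _)

  edgeFactor-represents : ∀ i j → Represents i j (edgeFactor (i , j))
  edgeFactor-represents i j a with (i , j) ∈? T
  ... | yes ij∈T = trans (eval-linear-0 i j a) (+-congʳ (sym (σ-tree i j ij∈T (a i))))
  ... | no  _    = begin
    eval R (interpolant i (displacement (σ i j)) ++ linear i j 0#) a
      ≈⟨ eval-++ (interpolant i (displacement (σ i j))) (linear i j 0#) a ⟩
    eval R (interpolant i (displacement (σ i j))) a + eval R (linear i j 0#) a
      ≈⟨ +-cong (eval-interpolant _ (displacement-cong (σ i j)) i a) (eval-linear-0 i j a) ⟩
    (Inverse.to (σ i j) (a i) - a i) + (a i - a j)
      ≈⟨ +-assoc _ _ _ ⟩
    Inverse.to (σ i j) (a i) + (- a i + (a i - a j))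
      ≈⟨ +-congˡ (trans (sym (+-assoc _ _ _)) (trans (+-congʳ (-‿inverseˡ (a i))) (+-identityˡ _))) ⟩
    Inverse.to (σ i j) (a i) - a j ∎

  deg-edgeFactor : ∀ e → Deg (edgeFactor e) (weight (_∈? T) d e)
  deg-edgeFactor (i , j) with (i , j) ∈? T
  ... | yes _ = deg-linear i j 0#
  ... | no  _ = deg-++ (deg-interpolant (displacement (σ i j)) (∑-displacement (σ i j)) i)
                       (deg-weaken (ℕ.>-nonZero⁻¹ d) (deg-linear i j 0#))

  coloringPolynomial : Poly R n
  coloringPolynomial = ∏ₚ edgeFactor edges

  coloringPolynomial-InF : ∀ κ → IsProperColoring R G σ κ → InF R G σ coloringPolynomial
  coloringPolynomial-InF = ∏ₚ-InF edgeFactor (λ {i} {j} _ → edgeFactor-represents i j)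

  -- at least n - 1 of the edges are tree edges, of weight 1 instead of d
  deg-coloringPolynomial : IsSpanningTree G T →
                           Deg coloringPolynomial (d ℕ.* (length edges ℕ.+ 1 ℕ.∸ n) ℕ.+ (n ℕ.∸ 1))
  deg-coloringPolynomial (T⊆E , T-connected , _) =
    deg-weaken (cost-bound d (length edges) n (sum-weight (_∈? T) d edges) n∸1≤#treeEdges)
               (deg-∏ₚ edgeFactor (weight (_∈? T) d) deg-edgeFactor edges)
    where
    n∸1≤#treeEdges : n ℕ.∸ 1 ≤ length (filter (_∈? T) edges)
    n∸1≤#treeEdges = connected⇒n∸1≤length _
      (connected-mono (λ e∈T → ∈-filter⁺ (_∈? T) (T⊆E e∈T) e∈T) T-connected)

module TwoElementField (R : CommutativeRing 0ℓ 0ℓ) (isField : IsField R) (ord : HasOrder R 2) where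
  open CommutativeRing R
  open Field R isField
  open Polynomials R
  open FiniteField R isField ord using (index; index-injective)
  open import Relation.Binary.Reasoning.Setoid setoid
  open import Algebra.Properties.Ring ring using (x+x≈x⇒x≈0; +-cancelˡ; +-cancelʳ)

  fin2-other : (a b c : Fin 2) → a ≢ b → c ≡ a ⊎ c ≡ b
  fin2-other Fin.zero           Fin.zero           _                  a≢b = ⊥-elim (a≢b ≡.refl)
  fin2-other Fin.zero           (Fin.suc Fin.zero) Fin.zero           _   = inj₁ ≡.refl
  fin2-other Fin.zero           (Fin.suc Fin.zero) (Fin.suc Fin.zero) _   = inj₂ ≡.refl
  fin2-other (Fin.suc Fin.zero) Fin.zero           Fin.zero           _   = inj₂ ≡.refl
  fin2-other (Fin.suc Fin.zero) Fin.zero           (Fin.suc Fin.zero) _   = inj₁ ≡.refl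
  fin2-other (Fin.suc Fin.zero) (Fin.suc Fin.zero) _                  a≢b = ⊥-elim (a≢b ≡.refl)

  0-or-1 : ∀ x → x ≈ 0# ⊎ x ≈ 1#
  0-or-1 x = Sum.map index-injective index-injective
    (fin2-other (index 0#) (index 1#) (index x) (λ i0≡i1 → 1≉0 (sym (index-injective i0≡i1))))

  ≉0⇒≈1 : ∀ {x} → ¬ (x ≈ 0#) → x ≈ 1#
  ≉0⇒≈1 {x} x≉0 = Sum.[ ⊥-elim ∘ x≉0 , (λ x≈1 → x≈1) ]′ (0-or-1 x)

  1+1≈0 : 1# + 1# ≈ 0#
  1+1≈0 with 0-or-1 (1# + 1#)
  ... | inj₁ 2≈0 = 2≈0
  ... | inj₂ 2≈1 = ⊥-elim (1≉0 (x+x≈x⇒x≈0 1# 2≈1))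

  ≉⇒≈+1 : ∀ {x y} → ¬ (x ≈ y) → x ≈ y + 1#
  ≉⇒≈+1 {x} {y} x≉y with 0-or-1 x | 0-or-1 y
  ... | inj₁ x≈0 | inj₁ y≈0 = ⊥-elim (x≉y (trans x≈0 (sym y≈0)))
  ... | inj₁ x≈0 | inj₂ y≈1 = trans x≈0 (trans (sym 1+1≈0) (+-congʳ (sym y≈1)))
  ... | inj₂ x≈1 | inj₁ y≈0 = trans x≈1 (trans (sym (+-identityˡ 1#)) (+-congʳ (sym y≈0)))
  ... | inj₂ x≈1 | inj₂ y≈1 = ⊥-elim (x≉y (trans x≈1 (sym y≈1)))

  to-+ : ∀ (π : Perm R) y t → Inverse.to π (y + t) ≈ Inverse.to π y + t
  to-+ π y t with 0-or-1 t
  ... | inj₁ t≈0 = trans (Inverse.to-cong π (trans (+-congˡ t≈0) (+-identityʳ y)))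
                         (sym (trans (+-congˡ t≈0) (+-identityʳ _)))
  ... | inj₂ t≈1 = trans (Inverse.to-cong π (+-congˡ t≈1)) (trans (≉⇒≈+1 π[y+1]≉πy) (+-congˡ (sym t≈1)))
    where
    π[y+1]≉πy : ¬ (Inverse.to π (y + 1#) ≈ Inverse.to π y)
    π[y+1]≉πy eq = 1≉0 (+-cancelˡ y 1# 0# (begin
      y + 1#                             ≈⟨ Inverse.strictlyInverseʳ π _ ⟨
      Inverse.from π (Inverse.to π (y + 1#)) ≈⟨ Inverse.inverseʳ π eq ⟩
      y                                  ≈⟨ +-identityʳ y ⟨
      y + 0#                             ∎))

  x+[-x+1]≈1 : ∀ x → x + (- x + 1#) ≈ 1#
  x+[-x+1]≈1 x = trans (sym (+-assoc _ _ _)) (trans (+-congʳ (-‿inverseʳ x)) (+-identityˡ 1#))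

  x+[-y+1]≈1⇒x≈y : ∀ {x y} → x + (- y + 1#) ≈ 1# → x ≈ y
  x+[-y+1]≈1⇒x≈y {x} {y} eq = +-cancelʳ (- y + 1#) x y (trans eq (sym (x+[-x+1]≈1 y)))

  x-y≈z-w⇒x≈z+[y-w] : ∀ {x y z w} → x - y ≈ z - w → x ≈ z + (y - w)
  x-y≈z-w⇒x≈z+[y-w] {x} {y} {z} {w} eq = begin
    x               ≈⟨ sym (trans (+-assoc x (- y) y) (trans (+-congˡ (-‿inverseˡ y)) (+-identityʳ x))) ⟩
    x - y + y       ≈⟨ +-congʳ eq ⟩
    z - w + y       ≈⟨ +-assoc z (- w) y ⟩
    z + (- w + y)   ≈⟨ +-congˡ (+-comm (- w) y) ⟩
    z + (y - w)     ∎

  module _ {n : ℕ} (G : SimpleGraph n) (σ : Labeling R G) where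

    proper-translate : ∀ {κ} → IsProperColoring R G σ κ → ∀ t → IsProperColoring R G σ (λ v → κ v + t)
    proper-translate κ-proper t i j ij∈E σ[κi+t]≈κj+t =
      κ-proper i j ij∈E (+-cancelʳ t _ _ (trans (sym (to-+ (σ i j) _ t)) σ[κi+t]≈κj+t))

    proper-cong : ∀ {κ a} → (∀ v → a v ≈ κ v) → IsProperColoring R G σ κ → IsProperColoring R G σ a
    proper-cong a≈κ κ-proper i j ij∈E σai≈aj =
      κ-proper i j ij∈E (trans (Inverse.to-cong (σ i j) (sym (a≈κ i))) (trans σai≈aj (a≈κ j)))

  module _ {n : ℕ} (G : SimpleGraph (suc n)) (σ : Labeling R G) (κ : Fin (suc n) → Carrier) where

    -- its only nonzero value is 1, attained exactly when a_v - a_0 ≈ κ_v - κ_0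
    offsetFactor : Fin n → Poly R (suc n)
    offsetFactor v = linear (Fin.suc v) Fin.zero (- (κ (Fin.suc v) - κ Fin.zero) + 1#)

    translates : Poly R (suc n)
    translates = ∏ₚ offsetFactor (List.allFin n)

    translates-nonzero⇒translate : ∀ a → ¬ (eval R translates a ≈ 0#) →
                                   ∀ u → a u ≈ κ u + (a Fin.zero - κ Fin.zero)
    translates-nonzero⇒translate a nonzero u = x-y≈z-w⇒x≈z+[y-w] (same-offset u)
      where
      same-offset : ∀ u → a u - a Fin.zero ≈ κ u - κ Fin.zero
      same-offset Fin.zero    = trans (-‿inverseʳ _) (sym (-‿inverseʳ _))
      same-offset (Fin.suc v) = x+[-y+1]≈1⇒x≈y (trans (sym (eval-linear (Fin.suc v) Fin.zero _ a))
        (≉0⇒≈1 (∏ₚ-factor≉0 offsetFactor (List.allFin n) a nonzero (∈-allFin v))))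

    translates-InF : IsProperColoring R G σ κ → InF R G σ translates
    translates-InF κ-proper = covers , κ , nonzero
      where
      covers : Covers R G σ translates
      covers a nonzero = proper-cong G σ (translates-nonzero⇒translate a nonzero)
                                     (proper-translate G σ κ-proper (a Fin.zero - κ Fin.zero))
      nonzero : ¬ (eval R translates κ ≈ 0#)
      nonzero = ∏ₚ-≉0 offsetFactor (List.allFin n) κ λ {v} _ factor≈0 →
        1≉0 (trans (sym (x+[-x+1]≈1 _)) (trans (sym (eval-linear (Fin.suc v) Fin.zero _ κ)) factor≈0))

    deg-translates : Deg translates n
    deg-translates = deg-weaken #factors≤n (deg-∏ₚ offsetFactor (λ _ → 1) deg-offsetFactor (List.allFin n))
      where
      deg-offsetFactor : ∀ v → Deg (offsetFactor v) 1
      deg-offsetFactor v = deg-linear (Fin.suc v) Fin.zero _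

      sum-ones : ∀ (vs : List (Fin n)) → sum (map (λ _ → 1) vs) ≡ length vs
      sum-ones []       = ≡.refl
      sum-ones (_ ∷ vs) = ≡.cong suc (sum-ones vs)

      #factors≤n : sum (map (λ _ → 1) (List.allFin n)) ≤ n
      #factors≤n = ℕ.≤-reflexive (≡.trans (sum-ones (List.allFin n)) (List.length-tabulate (λ v → v)))

  two-element-polynomial : ∀ {n} (G : SimpleGraph n) (σ : Labeling R G) κ → IsProperColoring R G σ κ →
                           Σ (Poly R n) λ f → InF R G σ f × DegreeAtMost R f (n ℕ.∸ 1)
  two-element-polynomial {zero}  G σ κ _        = 1ₚ , ((λ _ _ ()) , κ , 1ₚ≉0) , deg-constant 1#
    where
    1ₚ≉0 : ¬ (eval R 1ₚ κ ≈ 0#)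
    1ₚ≉0 1≈0 = 1≉0 (trans (sym (eval-constant 1# κ)) 1≈0)
  two-element-polynomial {suc n} G σ κ κ-proper =
    translates G σ κ , translates-InF G σ κ κ-proper , deg-translates G σ κ

open import Data.Nat using (_+_; _*_; _∸_)

-- The prime-power hypothesis and the connectivity of G are implied by the field and by T, and not used.
lemma3p7 : (k : ℕ) → IsPrimePower k →
    (R : CommutativeRing 0ℓ 0ℓ) → IsField R → HasOrder R k →
    (n m : ℕ) (G : SimpleGraph n) → length (SimpleGraph.edges G) ≡ m →
    Connected (SimpleGraph.edges G) →
    (T : List (Fin n × Fin n)) → IsSpanningTree G T →
    (σ : Labeling R G) →
    (∀ i j → (i , j) ∈ T → ∀ x →
    CommutativeRing._≈_ R (Inverse.to (σ i j) x) x) →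
    (∃ λ κ → IsProperColoring R G σ κ) →
    Σ (Poly R n) λ f → InF R G σ f ×
    DegreeAtMost R f ((k ∸ 2) * (m + 1 ∸ n) + (n ∸ 1))
lemma3p7 0 _ R isField ord _ _ _ _ _ _ _ _ _ _ with Field.order≥2 R isField ord
... | ()
lemma3p7 1 _ R isField ord _ _ _ _ _ _ _ _ _ _ with Field.order≥2 R isField ord
... | s≤s ()
lemma3p7 2 _ R isField ord n _ G _ _ _ _ σ _ (κ , κ-proper) =
  TwoElementField.two-element-polynomial R isField ord G σ κ κ-proper
lemma3p7 (suc (suc (suc d))) _ R isField ord n _ G ≡.refl _ T tree σ σ-tree (κ , κ-proper) =
  coloringPolynomial , coloringPolynomial-InF κ κ-proper , deg-coloringPolynomial tree
  where open SpanningTreeConstruction R isField ord G T σ σ-tree
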